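{- Consider words over the alphabet $\{U,D,R\}$, where $U=(1,1)$, and $D$ and $R$ both denote the step $(1,-1)$. Call such a word an admissible skew path if the lattice path it describes, starting at $(0,0)$, never goes below the $x$-axis, the word contains no factor $UR$ and no factor $RU$, and every maximal run of consecutive steps from $\{D,R\}$ that ends on the $x$-axis has odd length. Let $r_2=\frac{1+z^2-\sqrt{1-6z^2+5z^4}}{2z}$, and for $k\ge0$ let $g_k$ be the generating function ($z$ marking the number of steps) of admissible skew paths ending at level $k$ whose last step is $U$, together with the empty path when $k=0$. Then $g_0=1$ and, for $k\ge1$, $$g_k=\Big(\frac{r_2}{2-z^2}\Big)^k\,\frac{1+3z^2-zr_2}{1+z^2}.$$ Equivalently, $\sum_{k\ge0}g_ku^k=1+\dfrac{zu(1+3z^2-zr_2)}{(1+z^2)(1+z^2-zr_2-zu)}$.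
   Context: Here $R$ is a red down-step representing the south-west step of skew Dyck paths; the forbidden factors $UR$, $RU$ encode the no-overlap condition, and the parity condition is Stanley's restriction on down-runs (of either colour) to the $x$-axis. -}

module Defs where

open import Data.Bool using (Bool; true; false; _∧_; _∨_; not; T)
open import Data.Nat as ℕ using (ℕ; zero; suc)
open import Data.Integer as ℤ using (ℤ)
open import Data.Rational as ℚ using (ℚ; NonZero)
open import Data.List using (List; []; _∷_; concatMap; filter; length; last; sum; zipWith; map; upTo)
open import Data.Maybe using (Maybe; just; nothing)
open import Data.Bool.Properties using (T?)

data Step : Set where
  U D R : Step

words : ℕ → List (List Step)
words zero    = [] ∷ []
words (suc n) = concatMap (λ w → (U ∷ w) ∷ (D ∷ w) ∷ (R ∷ w) ∷ []) (words n)

oddB : ℕ → Bool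
oddB zero    = false
oddB (suc n) = not (oddB n)

runOK : ℕ → ℕ → Bool
runOK h       zero    = true
runOK zero    (suc r) = oddB (suc r)
runOK (suc h) (suc r) = true

-- Scan the word from (0,0): current height h, length r of the current run
-- of down steps.  Fails if a step goes below the x-axis or if a maximal
-- down-run ending on the x-axis has even length.
scan : ℕ → ℕ → List Step → Bool
scan h       r []      = runOK h r
scan h       r (U ∷ w) = runOK h r ∧ scan (suc h) 0 w
scan zero    r (D ∷ w) = false
scan (suc h) r (D ∷ w) = scan h (suc r) w
scan zero    r (R ∷ w) = false
scan (suc h) r (R ∷ w) = scan h (suc r) w

noUR-RU : List Step → Bool
noUR-RU (U ∷ R ∷ w) = false
noUR-RU (R ∷ U ∷ w) = false
noUR-RU (x ∷ w)     = noUR-RU w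
noUR-RU []          = true

admissible : List Step → Bool
admissible w = scan 0 0 w ∧ noUR-RU w

stepHeight : Step → ℤ
stepHeight U = ℤ.+ 1
stepHeight D = ℤ.- (ℤ.+ 1)
stepHeight R = ℤ.- (ℤ.+ 1)

endHeight : List Step → ℤ
endHeight w = sum' w
  where
    sum' : List Step → ℤ
    sum' []      = ℤ.0ℤ
    sum' (s ∷ v) = stepHeight s ℤ.+ sum' v

ℤeqB : ℤ → ℤ → Bool
ℤeqB a b = Relation.Nullary.Decidable.Core.does (a ℤ.≟ b)
  where import Relation.Nullary.Decidable.Core

emptyB : List Step → Bool
emptyB [] = true
emptyB (_ ∷ _) = false

lastIsU : List Step → Bool
lastIsU w with last w
... | just U = true
... | _      = false

countedByG : ℕ → List Step → Bool
countedByG k w = admissible w ∧ ℤeqB (endHeight w) (ℤ.+ k) ∧ (emptyB w ∨ lastIsU w)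

gCount : ℕ → ℕ → ℕ
gCount k n = length (filter (λ w → T? (countedByG k w)) (words n))

qsum : List ℚ → ℚ
qsum []       = ℚ.0ℚ
qsum (x ∷ xs) = x ℚ.+ qsum xs

Series : Set
Series = ℕ → ℚ

_≐_ : Series → Series → Set
f ≐ g = ∀ n → f n Relation.Binary.PropositionalEquality.≡ g n
  where import Relation.Binary.PropositionalEquality

infix 4 _≐_

const : ℚ → Series
const c zero    = c
const c (suc n) = ℚ.0ℚ

X : Series
X 1 = ℚ.1ℚ
X _ = ℚ.0ℚ

_⊕_ : Series → Series → Series
(f ⊕ g) n = f n ℚ.+ g n

_⊖_ : Series → Series → Series
(f ⊖ g) n = f n ℚ.- g n

_⊛_ : Series → Series → Series
(f ⊛ g) n = qsum (map (λ i → f i ℚ.* g (n ℕ.∸ i)) (upTo (suc n)))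

infixl 6 _⊕_ _⊖_
infixl 7 _⊛_

_^^_ : Series → ℕ → Series
f ^^ zero  = const ℚ.1ℚ
f ^^ suc k = f ⊛ (f ^^ k)

-- division by z (for series with zero constant term): coefficient shift
divZ : Series → Series
divZ f n = f (suc n)


-- coefficient n of a list of the form [aₙ, aₙ₋₁, …, a₀]
-- Multiplicative inverse of a series with nonzero constant term:
-- invRev f n = [gₙ, …, g₀] where g = 1/f, with
-- g₀ = 1/f₀,  gₙ₊₁ = -(1/f₀) Σ_{i=1}^{n+1} fᵢ gₙ₊₁₋ᵢ.
invRev : (f : Series) → .{{_ : NonZero (f 0)}} → ℕ → List ℚ
invRev f zero    = (ℚ.1/ f 0) ∷ []
invRev f (suc n) =
  ℚ.- ((ℚ.1/ f 0) ℚ.* qsum (zipWith ℚ._*_ (map (λ j → f (suc j)) (upTo (suc n))) prev))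
  ∷ prev
  where prev = invRev f n

headQ : List ℚ → ℚ
headQ []      = ℚ.0ℚ
headQ (x ∷ _) = x

inv : (f : Series) → .{{_ : NonZero (f 0)}} → Series
inv f n = headQ (invRev f n)

-- Square root of a series with constant term 1: the unique series s with
-- s₀ = 1 and s·s = f, i.e. s₀ = 1 and for n ≥ 1
-- sₙ = (fₙ - Σ_{i=1}^{n-1} sᵢ sₙ₋ᵢ) / 2.
-- sqrtRev f n = [sₙ, …, s₀].
sqrtRev : Series → ℕ → List ℚ
sqrtRev f zero    = ℚ.1ℚ ∷ []
sqrtRev f (suc n) = new ∷ prev
  where
    prev = sqrtRev f n
    -- prev = [sₙ, …, s₀]; cross = Σ_{i=1}^{n} sᵢ s_{n+1-i}
    -- = Σ over j=0..n of prev[j] * prev[n-j] minus the two s₀ terms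
    init' : List ℚ → List ℚ
    init' []           = []
    init' (x ∷ [])     = []
    init' (x ∷ y ∷ ys) = x ∷ init' (y ∷ ys)
    rev : List ℚ → List ℚ
    rev = Data.List.reverse
      where import Data.List
    -- mid = [sₙ, …, s₁]
    mid = init' prev
    cross = qsum (zipWith ℚ._*_ mid (rev mid))
    new = ℚ.½ ℚ.* (f (suc n) ℚ.- cross)

sqrtS : Series → Series
sqrtS f n = headQ (sqrtRev f n)

ℚn : ℕ → ℚ
ℚn n = ℤ.+ n ℚ./ 1

Z2 : Series
Z2 = X ^^ 2

Δ : Series
Δ = const ℚ.1ℚ ⊖ const (ℚn 6) ⊛ (X ^^ 2) ⊕ const (ℚn 5) ⊛ (X ^^ 4)

r₂ : Series
r₂ = const ℚ.½ ⊛ divZ (const ℚ.1ℚ ⊕ Z2 ⊖ sqrtS Δ)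

twoMinusZ2 : Series
twoMinusZ2 = const (ℚn 2) ⊖ Z2

onePlusZ2 : Series
onePlusZ2 = const ℚ.1ℚ ⊕ Z2

gFormula : ℕ → Series
gFormula k =
  ((r₂ ⊛ inv twoMinusZ2) ^^ k)
    ⊛ ((const ℚ.1ℚ ⊕ const (ℚn 3) ⊛ Z2 ⊖ X ⊛ r₂) ⊛ inv onePlusZ2)

gSeries : ℕ → Series
gSeries k n = ℚn (gCount k n)

-- A nonempty path is summarised by its last step, its height and, when it ends with a
-- down-run, the parity of the length of that run. Reading a word from left to right
-- updates this summary deterministically, admissibility is decided along the way, and g_k
-- counts the words whose final summary is "last step U at height k". Counting words by
-- their final summary gives a linear recurrence over the predecessors of each summary, so
-- any family of power series obeying the matching transfer equations has these counts as
-- coefficients.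
--
-- That family is found in closed form. With A = r₂/(2 − z²), B = (1 + 3z² − z r₂)/(1 + z²),
-- y = zA and σ = y²/(1 − 4y²), the summary "U at height k ≥ 1" gets A^k B, and a final
-- down-run at height h gets σ A^h B when its length is even, (y + 2yσ) A^h B when it is an
-- odd run of D-steps and 2yσ A^h B when it is an odd run of R-steps. The transfer equations
-- reduce to A = z(1 + σ + y + 2yσ) and (1 + σ)B = 1, which follow from the quadratic
-- equation z r² − (1 + z²) r + z(2 − z²) = 0 for r₂, itself a consequence of
-- (1 + z² − 2z r₂)² = 1 − 6z² + 5z⁴.

module Submission where

open import Defs
open import Data.Nat using (ℕ; zero; suc; _≤_)
open import Data.Product using (_×_; _,_)
open import Data.Rational using (ℚ; 1ℚ)
open import Relation.Binary.PropositionalEquality using (_≡_; refl; sym; trans; cong)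

module PowerSeries where

  open import Algebra.Bundles using (CommutativeRing)
  import Algebra.Properties.CommutativeSemigroup as CommutativeSemigroupProperties
  import Algebra.Properties.Group as GroupProperties
  import Algebra.Solver.Ring
  import Algebra.Solver.Ring.AlmostCommutativeRing as ACR
  import Data.Integer as ℤ
  import Data.Integer.Properties as ℤ
  open import Data.List using (List; []; _∷_; map; foldr; upTo; downFrom; zipWith; reverse)
  import Data.List.Properties as List
  open import Data.Maybe using (Maybe; just; nothing)
  import Data.Nat as ℕ
  import Data.Nat.Coprimality as Coprimality
  open import Data.Nat.ListAction using (sum)
  open import Data.Rational using (0ℚ; ½; mkℚ; _+_; _*_; -_; _-_; _/_; 1/_; NonZero)
  import Data.Rational.Properties as ℚ
  open import Data.Rational.Solver using (module +-*-Solver)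
  open import Function using (_∘_)
  open import Relation.Binary.Bundles using (Setoid)
  open import Relation.Binary.PropositionalEquality using (cong₂; module ≡-Reasoning)
  open import Relation.Binary.Structures using (IsEquivalence)
  open import Relation.Nullary using (yes; no)

  open CommutativeSemigroupProperties (CommutativeRing.+-commutativeSemigroup ℚ.+-*-commutativeRing)
    using (interchange)

  ≐-refl : {f : Series} → f ≐ f
  ≐-refl n = refl

  ≐-sym : {f g : Series} → f ≐ g → g ≐ f
  ≐-sym p n = sym (p n)

  ≐-trans : {f g h : Series} → f ≐ g → g ≐ h → f ≐ h
  ≐-trans p q n = trans (p n) (q n)

  ≐-isEquivalence : IsEquivalence _≐_
  ≐-isEquivalence = record { refl = ≐-refl ; sym = ≐-sym ; trans = ≐-trans }

  ≐-setoid : Setoid _ _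
  ≐-setoid = record { isEquivalence = ≐-isEquivalence }

  0ₛ 1ₛ : Series
  0ₛ = const 0ℚ
  1ₛ = const 1ℚ

  _·_ : ℚ → Series → Series
  (c · f) n = c * f n

  ⊕-cong : {f f′ g g′ : Series} → f ≐ f′ → g ≐ g′ → f ⊕ g ≐ f′ ⊕ g′
  ⊕-cong p q n = cong₂ _+_ (p n) (q n)

  ⊖-cong : {f f′ g g′ : Series} → f ≐ f′ → g ≐ g′ → f ⊖ g ≐ f′ ⊖ g′
  ⊖-cong p q n = cong₂ _-_ (p n) (q n)

  0ₛ-coeff : (n : ℕ) → 0ₛ n ≡ 0ℚ
  0ₛ-coeff zero    = refl
  0ₛ-coeff (suc n) = refl

  map-upTo-suc : {A : Set} (h : ℕ → A) (n : ℕ) → map h (upTo (suc n)) ≡ h 0 ∷ map (h ∘ suc) (upTo n)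
  map-upTo-suc h n = cong (h 0 ∷_) (trans (List.map-applyUpTo suc h n) (sym (List.map-upTo (h ∘ suc) n)))

  ⊛-coeff-zero : (f g : Series) → (f ⊛ g) 0 ≡ f 0 * g 0
  ⊛-coeff-zero f g = ℚ.+-identityʳ (f 0 * g 0)

  ⊛-coeff-suc : (f g : Series) (n : ℕ) → (f ⊛ g) (suc n) ≡ f 0 * g (suc n) + (divZ f ⊛ g) n
  ⊛-coeff-suc f g n = cong qsum (map-upTo-suc (λ i → f i * g (suc n ℕ.∸ i)) (suc n))

  ⊛-coeff-sucʳ : (f g : Series) (n : ℕ) → (f ⊛ g) (suc n) ≡ (f ⊛ divZ g) n + f (suc n) * g 0
  ⊛-coeff-sucʳ f g zero = begin
    (f ⊛ g) 1                   ≡⟨ ⊛-coeff-suc f g 0 ⟩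
    f 0 * g 1 + (divZ f ⊛ g) 0  ≡⟨ cong (f 0 * g 1 +_) (⊛-coeff-zero (divZ f) g) ⟩
    f 0 * g 1 + f 1 * g 0       ≡⟨ cong (_+ f 1 * g 0) (⊛-coeff-zero f (divZ g)) ⟨
    (f ⊛ divZ g) 0 + f 1 * g 0  ∎
    where open ≡-Reasoning
  ⊛-coeff-sucʳ f g (suc n) = begin
    (f ⊛ g) (2 ℕ.+ n)                                              ≡⟨ ⊛-coeff-suc f g (suc n) ⟩
    f 0 * g (2 ℕ.+ n) + (divZ f ⊛ g) (suc n)                       ≡⟨ cong (f 0 * g (2 ℕ.+ n) +_) (⊛-coeff-sucʳ (divZ f) g n) ⟩
    f 0 * g (2 ℕ.+ n) + ((divZ f ⊛ divZ g) n + f (2 ℕ.+ n) * g 0)  ≡⟨ ℚ.+-assoc (f 0 * g (2 ℕ.+ n)) _ _ ⟨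
    f 0 * g (2 ℕ.+ n) + (divZ f ⊛ divZ g) n + f (2 ℕ.+ n) * g 0    ≡⟨ cong (_+ f (2 ℕ.+ n) * g 0) (⊛-coeff-suc f (divZ g) n) ⟨
    (f ⊛ divZ g) (suc n) + f (2 ℕ.+ n) * g 0                       ∎
    where open ≡-Reasoning

  ⊛-congˡ : {f f′ : Series} (g : Series) → f ≐ f′ → f ⊛ g ≐ f′ ⊛ g
  ⊛-congˡ {f} {f′} g p zero = begin
    (f ⊛ g) 0    ≡⟨ ⊛-coeff-zero f g ⟩
    f 0 * g 0    ≡⟨ cong (_* g 0) (p 0) ⟩
    f′ 0 * g 0   ≡⟨ ⊛-coeff-zero f′ g ⟨
    (f′ ⊛ g) 0   ∎
    where open ≡-Reasoning
  ⊛-congˡ {f} {f′} g p (suc n) = begin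
    (f ⊛ g) (suc n)                     ≡⟨ ⊛-coeff-suc f g n ⟩
    f 0 * g (suc n) + (divZ f ⊛ g) n    ≡⟨ cong₂ _+_ (cong (_* g (suc n)) (p 0)) (⊛-congˡ g (p ∘ suc) n) ⟩
    f′ 0 * g (suc n) + (divZ f′ ⊛ g) n  ≡⟨ ⊛-coeff-suc f′ g n ⟨
    (f′ ⊛ g) (suc n)                    ∎
    where open ≡-Reasoning

  ⊛-comm : (f g : Series) → f ⊛ g ≐ g ⊛ f
  ⊛-comm f g zero = begin
    (f ⊛ g) 0   ≡⟨ ⊛-coeff-zero f g ⟩
    f 0 * g 0   ≡⟨ ℚ.*-comm (f 0) (g 0) ⟩
    g 0 * f 0   ≡⟨ ⊛-coeff-zero g f ⟨
    (g ⊛ f) 0   ∎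
    where open ≡-Reasoning
  ⊛-comm f g (suc n) = begin
    (f ⊛ g) (suc n)                   ≡⟨ ⊛-coeff-suc f g n ⟩
    f 0 * g (suc n) + (divZ f ⊛ g) n  ≡⟨ cong₂ _+_ (ℚ.*-comm (f 0) (g (suc n))) (⊛-comm (divZ f) g n) ⟩
    g (suc n) * f 0 + (g ⊛ divZ f) n  ≡⟨ ℚ.+-comm (g (suc n) * f 0) _ ⟩
    (g ⊛ divZ f) n + g (suc n) * f 0  ≡⟨ ⊛-coeff-sucʳ g f n ⟨
    (g ⊛ f) (suc n)                   ∎
    where open ≡-Reasoning

  ⊛-congʳ : (f : Series) {g g′ : Series} → g ≐ g′ → f ⊛ g ≐ f ⊛ g′
  ⊛-congʳ f {g} {g′} p = ≐-trans (⊛-comm f g) (≐-trans (⊛-congˡ f p) (⊛-comm g′ f))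

  ⊛-cong : {f f′ g g′ : Series} → f ≐ f′ → g ≐ g′ → f ⊛ g ≐ f′ ⊛ g′
  ⊛-cong {f′ = f′} {g = g} p q = ≐-trans (⊛-congˡ g p) (⊛-congʳ f′ q)

  ⊛-distribʳ : (f g h : Series) → (f ⊕ g) ⊛ h ≐ f ⊛ h ⊕ g ⊛ h
  ⊛-distribʳ f g h zero = begin
    ((f ⊕ g) ⊛ h) 0          ≡⟨ ⊛-coeff-zero (f ⊕ g) h ⟩
    (f 0 + g 0) * h 0        ≡⟨ ℚ.*-distribʳ-+ (h 0) (f 0) (g 0) ⟩
    f 0 * h 0 + g 0 * h 0    ≡⟨ cong₂ _+_ (⊛-coeff-zero f h) (⊛-coeff-zero g h) ⟨
    (f ⊛ h) 0 + (g ⊛ h) 0    ∎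
    where open ≡-Reasoning
  ⊛-distribʳ f g h (suc n) = begin
    ((f ⊕ g) ⊛ h) (suc n)
      ≡⟨ ⊛-coeff-suc (f ⊕ g) h n ⟩
    (f 0 + g 0) * h (suc n) + ((divZ f ⊕ divZ g) ⊛ h) n
      ≡⟨ cong₂ _+_ (ℚ.*-distribʳ-+ (h (suc n)) (f 0) (g 0)) (⊛-distribʳ (divZ f) (divZ g) h n) ⟩
    (f 0 * h (suc n) + g 0 * h (suc n)) + ((divZ f ⊛ h) n + (divZ g ⊛ h) n)
      ≡⟨ interchange (f 0 * h (suc n)) (g 0 * h (suc n)) ((divZ f ⊛ h) n) ((divZ g ⊛ h) n) ⟩
    (f 0 * h (suc n) + (divZ f ⊛ h) n) + (g 0 * h (suc n) + (divZ g ⊛ h) n)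
      ≡⟨ cong₂ _+_ (⊛-coeff-suc f h n) (⊛-coeff-suc g h n) ⟨
    (f ⊛ h) (suc n) + (g ⊛ h) (suc n)
      ∎
    where open ≡-Reasoning

  ⊛-distribˡ : (f g h : Series) → f ⊛ (g ⊕ h) ≐ f ⊛ g ⊕ f ⊛ h
  ⊛-distribˡ f g h n = begin
    (f ⊛ (g ⊕ h)) n        ≡⟨ ⊛-comm f (g ⊕ h) n ⟩
    ((g ⊕ h) ⊛ f) n        ≡⟨ ⊛-distribʳ g h f n ⟩
    (g ⊛ f) n + (h ⊛ f) n  ≡⟨ cong₂ _+_ (⊛-comm g f n) (⊛-comm h f n) ⟩
    (f ⊛ g) n + (f ⊛ h) n  ∎
    where open ≡-Reasoning

  ·-⊛ : (c : ℚ) (f g : Series) → (c · f) ⊛ g ≐ c · (f ⊛ g)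
  ·-⊛ c f g zero = begin
    ((c · f) ⊛ g) 0  ≡⟨ ⊛-coeff-zero (c · f) g ⟩
    c * f 0 * g 0    ≡⟨ ℚ.*-assoc c (f 0) (g 0) ⟩
    c * (f 0 * g 0)  ≡⟨ cong (c *_) (⊛-coeff-zero f g) ⟨
    c * (f ⊛ g) 0    ∎
    where open ≡-Reasoning
  ·-⊛ c f g (suc n) = begin
    ((c · f) ⊛ g) (suc n)                       ≡⟨ ⊛-coeff-suc (c · f) g n ⟩
    c * f 0 * g (suc n) + ((c · divZ f) ⊛ g) n  ≡⟨ cong₂ _+_ (ℚ.*-assoc c (f 0) (g (suc n))) (·-⊛ c (divZ f) g n) ⟩
    c * (f 0 * g (suc n)) + c * (divZ f ⊛ g) n  ≡⟨ ℚ.*-distribˡ-+ c _ _ ⟨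
    c * (f 0 * g (suc n) + (divZ f ⊛ g) n)      ≡⟨ cong (c *_) (⊛-coeff-suc f g n) ⟨
    c * (f ⊛ g) (suc n)                         ∎
    where open ≡-Reasoning

  ⊛-assoc : (f g h : Series) → (f ⊛ g) ⊛ h ≐ f ⊛ (g ⊛ h)
  ⊛-assoc f g h zero = begin
    ((f ⊛ g) ⊛ h) 0    ≡⟨ ⊛-coeff-zero (f ⊛ g) h ⟩
    (f ⊛ g) 0 * h 0    ≡⟨ cong (_* h 0) (⊛-coeff-zero f g) ⟩
    f 0 * g 0 * h 0    ≡⟨ ℚ.*-assoc (f 0) (g 0) (h 0) ⟩
    f 0 * (g 0 * h 0)  ≡⟨ cong (f 0 *_) (⊛-coeff-zero g h) ⟨
    f 0 * (g ⊛ h) 0    ≡⟨ ⊛-coeff-zero f (g ⊛ h) ⟨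
    (f ⊛ (g ⊛ h)) 0    ∎
    where open ≡-Reasoning
  ⊛-assoc f g h (suc n) = begin
    ((f ⊛ g) ⊛ h) (suc n)
      ≡⟨ ⊛-coeff-suc (f ⊛ g) h n ⟩
    (f ⊛ g) 0 * h (suc n) + (divZ (f ⊛ g) ⊛ h) n
      ≡⟨ cong₂ _+_ (cong (_* h (suc n)) (⊛-coeff-zero f g)) (⊛-congˡ h (⊛-coeff-suc f g) n) ⟩
    f 0 * g 0 * h (suc n) + ((f 0 · divZ g ⊕ divZ f ⊛ g) ⊛ h) n
      ≡⟨ cong (f 0 * g 0 * h (suc n) +_) (⊛-distribʳ (f 0 · divZ g) (divZ f ⊛ g) h n) ⟩
    f 0 * g 0 * h (suc n) + (((f 0 · divZ g) ⊛ h) n + ((divZ f ⊛ g) ⊛ h) n)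
      ≡⟨ cong (f 0 * g 0 * h (suc n) +_) (cong₂ _+_ (·-⊛ (f 0) (divZ g) h n) (⊛-assoc (divZ f) g h n)) ⟩
    f 0 * g 0 * h (suc n) + (f 0 * (divZ g ⊛ h) n + (divZ f ⊛ (g ⊛ h)) n)
      ≡⟨ ℚ.+-assoc (f 0 * g 0 * h (suc n)) _ _ ⟨
    f 0 * g 0 * h (suc n) + f 0 * (divZ g ⊛ h) n + (divZ f ⊛ (g ⊛ h)) n
      ≡⟨ cong (_+ (divZ f ⊛ (g ⊛ h)) n) factor-f₀ ⟩
    f 0 * (g ⊛ h) (suc n) + (divZ f ⊛ (g ⊛ h)) n
      ≡⟨ ⊛-coeff-suc f (g ⊛ h) n ⟨
    (f ⊛ (g ⊛ h)) (suc n)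
      ∎
    where
    open ≡-Reasoning
    factor-f₀ : f 0 * g 0 * h (suc n) + f 0 * (divZ g ⊛ h) n ≡ f 0 * (g ⊛ h) (suc n)
    factor-f₀ = begin
      f 0 * g 0 * h (suc n) + f 0 * (divZ g ⊛ h) n    ≡⟨ cong (_+ f 0 * (divZ g ⊛ h) n) (ℚ.*-assoc (f 0) (g 0) (h (suc n))) ⟩
      f 0 * (g 0 * h (suc n)) + f 0 * (divZ g ⊛ h) n  ≡⟨ ℚ.*-distribˡ-+ (f 0) _ _ ⟨
      f 0 * (g 0 * h (suc n) + (divZ g ⊛ h) n)        ≡⟨ cong (f 0 *_) (⊛-coeff-suc g h n) ⟨
      f 0 * (g ⊛ h) (suc n)                           ∎

  ⊛-vanishingˡ : {f : Series} (g : Series) → (∀ n → f n ≡ 0ℚ) → ∀ n → (f ⊛ g) n ≡ 0ℚ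
  ⊛-vanishingˡ {f} g p zero = begin
    (f ⊛ g) 0  ≡⟨ ⊛-coeff-zero f g ⟩
    f 0 * g 0  ≡⟨ cong (_* g 0) (p 0) ⟩
    0ℚ * g 0   ≡⟨ ℚ.*-zeroˡ (g 0) ⟩
    0ℚ         ∎
    where open ≡-Reasoning
  ⊛-vanishingˡ {f} g p (suc n) = begin
    (f ⊛ g) (suc n)                   ≡⟨ ⊛-coeff-suc f g n ⟩
    f 0 * g (suc n) + (divZ f ⊛ g) n  ≡⟨ cong₂ _+_ (cong (_* g (suc n)) (p 0)) (⊛-vanishingˡ g (p ∘ suc) n) ⟩
    0ℚ * g (suc n) + 0ℚ               ≡⟨ cong (_+ 0ℚ) (ℚ.*-zeroˡ (g (suc n))) ⟩
    0ℚ                                ∎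
    where open ≡-Reasoning

  const-⊛ : (c : ℚ) (f : Series) → const c ⊛ f ≐ c · f
  const-⊛ c f zero    = ⊛-coeff-zero (const c) f
  const-⊛ c f (suc n) = begin
    (const c ⊛ f) (suc n)                   ≡⟨ ⊛-coeff-suc (const c) f n ⟩
    c * f (suc n) + (divZ (const c) ⊛ f) n  ≡⟨ cong (c * f (suc n) +_) (⊛-vanishingˡ f (λ _ → refl) n) ⟩
    c * f (suc n) + 0ℚ                      ≡⟨ ℚ.+-identityʳ _ ⟩
    c * f (suc n)                           ∎
    where open ≡-Reasoning

  ⊛-identityˡ : (f : Series) → 1ₛ ⊛ f ≐ f
  ⊛-identityˡ f n = trans (const-⊛ 1ℚ f n) (ℚ.*-identityˡ (f n))

  ⊛-identityʳ : (f : Series) → f ⊛ 1ₛ ≐ f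
  ⊛-identityʳ f = ≐-trans (⊛-comm f 1ₛ) (⊛-identityˡ f)

  seriesCommutativeRing : CommutativeRing _ _
  seriesCommutativeRing = record
    { Carrier = Series
    ; _≈_ = _≐_
    ; _+_ = _⊕_
    ; _*_ = _⊛_
    ; -_ = λ f n → - f n
    ; 0# = 0ₛ
    ; 1# = 1ₛ
    ; isCommutativeRing = record
      { isRing = record
        { +-isAbelianGroup = record
          { isGroup = record
            { isMonoid = record
              { isSemigroup = record
                { isMagma = record { isEquivalence = ≐-isEquivalence ; ∙-cong = ⊕-cong }
                ; assoc = λ f g h n → ℚ.+-assoc (f n) (g n) (h n)
                }
              ; identity = (λ f n → trans (cong (_+ f n) (0ₛ-coeff n)) (ℚ.+-identityˡ (f n)))
                         , (λ f n → trans (cong (f n +_) (0ₛ-coeff n)) (ℚ.+-identityʳ (f n)))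
              }
            ; inverse = (λ f n → trans (ℚ.+-inverseˡ (f n)) (sym (0ₛ-coeff n)))
                      , (λ f n → trans (ℚ.+-inverseʳ (f n)) (sym (0ₛ-coeff n)))
            ; ⁻¹-cong = λ p n → cong -_ (p n)
            }
          ; comm = λ f g n → ℚ.+-comm (f n) (g n)
          }
        ; *-cong = ⊛-cong
        ; *-assoc = ⊛-assoc
        ; *-identity = ⊛-identityˡ , ⊛-identityʳ
        ; distrib = ⊛-distribˡ , λ h f g → ⊛-distribʳ f g h
        }
      ; *-comm = ⊛-comm
      }
    }

  const-homomorphism : CommutativeRing.rawRing ℚ.+-*-commutativeRing
                         ACR.-Raw-AlmostCommutative⟶ ACR.fromCommutativeRing seriesCommutativeRing
  const-homomorphism = record
    { ⟦_⟧ = const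
    ; +-homo = λ { a b zero → refl ; a b (suc n) → refl }
    ; *-homo = λ a b n → sym (trans (const-⊛ a (const b) n) (·-const a b n))
    ; -‿homo = λ { a zero → refl ; a (suc n) → refl }
    ; 0-homo = ≐-refl
    ; 1-homo = ≐-refl
    }
    where
    ·-const : (a b : ℚ) → a · const b ≐ const (a * b)
    ·-const a b zero    = refl
    ·-const a b (suc n) = ℚ.*-zeroʳ a

  const-≟ : (a b : ℚ) → Maybe (const a ≐ const b)
  const-≟ a b with a ℚ.≟ b
  ... | yes a≡b = just (λ n → cong (λ c → const c n) a≡b)
  ... | no _    = nothing

  module SeriesSolver = Algebra.Solver.Ring (CommutativeRing.rawRing ℚ.+-*-commutativeRing)
    (ACR.fromCommutativeRing seriesCommutativeRing) const-homomorphism const-≟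

  X⊛-coeff-zero : (f : Series) → (X ⊛ f) 0 ≡ 0ℚ
  X⊛-coeff-zero f = trans (⊛-coeff-zero X f) (ℚ.*-zeroˡ (f 0))

  X⊛-coeff-suc : (f : Series) (n : ℕ) → (X ⊛ f) (suc n) ≡ f n
  X⊛-coeff-suc f n = begin
    (X ⊛ f) (suc n)                  ≡⟨ ⊛-coeff-suc X f n ⟩
    0ℚ * f (suc n) + (divZ X ⊛ f) n  ≡⟨ cong₂ _+_ (ℚ.*-zeroˡ (f (suc n))) (⊛-congˡ f divZ-X n) ⟩
    0ℚ + (1ₛ ⊛ f) n                  ≡⟨ ℚ.+-identityˡ _ ⟩
    (1ₛ ⊛ f) n                       ≡⟨ ⊛-identityˡ f n ⟩
    f n                              ∎
    where
    open ≡-Reasoning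
    divZ-X : divZ X ≐ 1ₛ
    divZ-X zero    = refl
    divZ-X (suc n) = refl

  X⊛-divZ : (f : Series) → f 0 ≡ 0ℚ → f ≐ X ⊛ divZ f
  X⊛-divZ f f₀≡0 zero    = trans f₀≡0 (sym (X⊛-coeff-zero (divZ f)))
  X⊛-divZ f f₀≡0 (suc n) = sym (X⊛-coeff-suc (divZ f) n)

  X⊛-cancel : {f g : Series} → X ⊛ f ≐ X ⊛ g → f ≐ g
  X⊛-cancel {f} {g} p n = begin
    f n              ≡⟨ X⊛-coeff-suc f n ⟨
    (X ⊛ f) (suc n)  ≡⟨ p (suc n) ⟩
    (X ⊛ g) (suc n)  ≡⟨ X⊛-coeff-suc g n ⟩
    g n              ∎
    where open ≡-Reasoning

  zipWith-upTo-downFrom : (a b : ℕ → ℚ) (n : ℕ) →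
    zipWith _*_ (map a (upTo (suc n))) (map b (downFrom (suc n))) ≡ map (λ i → a i * b (n ℕ.∸ i)) (upTo (suc n))
  zipWith-upTo-downFrom a b zero    = refl
  zipWith-upTo-downFrom a b (suc n) = begin
    zipWith _*_ (map a (upTo (2 ℕ.+ n))) (map b (downFrom (2 ℕ.+ n)))
      ≡⟨ cong (λ as → zipWith _*_ as (map b (downFrom (2 ℕ.+ n)))) (map-upTo-suc a (suc n)) ⟩
    a 0 * b (suc n) ∷ zipWith _*_ (map (a ∘ suc) (upTo (suc n))) (map b (downFrom (suc n)))
      ≡⟨ cong (a 0 * b (suc n) ∷_) (zipWith-upTo-downFrom (a ∘ suc) b n) ⟩
    a 0 * b (suc n) ∷ map (λ i → a (suc i) * b (n ℕ.∸ i)) (upTo (suc n))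
      ≡⟨ map-upTo-suc (λ i → a i * b (suc n ℕ.∸ i)) (suc n) ⟨
    map (λ i → a i * b (suc n ℕ.∸ i)) (upTo (2 ℕ.+ n))
      ∎
    where open ≡-Reasoning

  invRev-downFrom : (f : Series) .{{_ : NonZero (f 0)}} (n : ℕ) → invRev f n ≡ map (inv f) (downFrom (suc n))
  invRev-downFrom f zero    = refl
  invRev-downFrom f (suc n) = cong (inv f (suc n) ∷_) (invRev-downFrom f n)

  inv-coeff-suc : (f : Series) .{{_ : NonZero (f 0)}} (n : ℕ) → inv f (suc n) ≡ - (1/ f 0 * (divZ f ⊛ inv f) n)
  inv-coeff-suc f n = cong (λ xs → - (1/ f 0 * qsum xs)) (begin
    zipWith _*_ (map (divZ f) (upTo (suc n))) (invRev f n)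
      ≡⟨ cong (zipWith _*_ (map (divZ f) (upTo (suc n)))) (invRev-downFrom f n) ⟩
    zipWith _*_ (map (divZ f) (upTo (suc n))) (map (inv f) (downFrom (suc n)))
      ≡⟨ zipWith-upTo-downFrom (divZ f) (inv f) n ⟩
    map (λ i → divZ f i * inv f (n ℕ.∸ i)) (upTo (suc n))
      ∎)
    where open ≡-Reasoning

  ⊛-inverseʳ : (f : Series) .{{_ : NonZero (f 0)}} → f ⊛ inv f ≐ 1ₛ
  ⊛-inverseʳ f zero    = trans (⊛-coeff-zero f (inv f)) (ℚ.*-inverseʳ (f 0))
  ⊛-inverseʳ f (suc n) = begin
    (f ⊛ inv f) (suc n)       ≡⟨ ⊛-coeff-suc f (inv f) n ⟩
    f 0 * inv f (suc n) + c   ≡⟨ cong (λ x → f 0 * x + c) (inv-coeff-suc f n) ⟩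
    f 0 * - (1/ f 0 * c) + c  ≡⟨ cong (_+ c) (ℚ.neg-distribʳ-* (f 0) (1/ f 0 * c)) ⟨
    - (f 0 * (1/ f 0 * c)) + c ≡⟨ cong (λ x → - x + c) (ℚ.*-assoc (f 0) (1/ f 0) c) ⟨
    - (f 0 * 1/ f 0 * c) + c  ≡⟨ cong (λ x → - (x * c) + c) (ℚ.*-inverseʳ (f 0)) ⟩
    - (1ℚ * c) + c            ≡⟨ cong (λ x → - x + c) (ℚ.*-identityˡ c) ⟩
    - c + c                   ≡⟨ ℚ.+-inverseˡ c ⟩
    0ℚ                        ∎
    where
    open ≡-Reasoning
    c = (divZ f ⊛ inv f) n

  ⊛-inv-⊛ : (f d : Series) .{{_ : NonZero (d 0)}} → (f ⊛ inv d) ⊛ d ≐ f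
  ⊛-inv-⊛ f d = ≐-trans (⊛-assoc f (inv d) d)
    (≐-trans (⊛-congʳ f (≐-trans (⊛-comm (inv d) d) (⊛-inverseʳ d))) (⊛-identityʳ f))

  ⊛-⊛-inv : (f d : Series) .{{_ : NonZero (d 0)}} → (f ⊛ d) ⊛ inv d ≐ f
  ⊛-⊛-inv f d = ≐-trans (⊛-assoc f d (inv d)) (≐-trans (⊛-congʳ f (⊛-inverseʳ d)) (⊛-identityʳ f))

  ⊛-cancelʳ : {f g : Series} (d : Series) .{{_ : NonZero (d 0)}} → f ⊛ d ≐ g ⊛ d → f ≐ g
  ⊛-cancelʳ {f} {g} d p = ≐-trans (≐-sym (⊛-⊛-inv f d)) (≐-trans (⊛-congˡ (inv d) p) (⊛-⊛-inv g d))

  sqrtRev-downFrom : (f : Series) (n : ℕ) → sqrtRev f n ≡ map (sqrtS f) (downFrom (suc n))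
  sqrtRev-downFrom f zero    = refl
  sqrtRev-downFrom f (suc n) = cong (sqrtS f (suc n) ∷_) (sqrtRev-downFrom f n)

  dropLast : List ℚ → List ℚ
  dropLast []           = []
  dropLast (x ∷ [])     = []
  dropLast (x ∷ y ∷ ys) = x ∷ dropLast (y ∷ ys)

  dropLast-downFrom : (s : ℕ → ℚ) (m : ℕ) → dropLast (map s (downFrom (2 ℕ.+ m))) ≡ map (s ∘ suc) (downFrom (suc m))
  dropLast-downFrom s zero    = refl
  dropLast-downFrom s (suc m) = cong (s (2 ℕ.+ m) ∷_) (dropLast-downFrom s m)

  qsum-zipWith-reverse : (s : ℕ → ℚ) (m : ℕ) → let xs = map s (downFrom (suc m)) in
    qsum (zipWith _*_ xs (reverse xs)) ≡ (s ⊛ s) m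
  qsum-zipWith-reverse s m = cong qsum (begin
    zipWith _*_ (map s (downFrom (suc m))) (reverse (map s (downFrom (suc m))))
      ≡⟨ cong (zipWith _*_ (map s (downFrom (suc m)))) (List.reverse-map s (downFrom (suc m))) ⟨
    zipWith _*_ (map s (downFrom (suc m))) (map s (reverse (downFrom (suc m))))
      ≡⟨ cong (λ is → zipWith _*_ (map s (downFrom (suc m))) (map s is)) (List.reverse-downFrom (suc m)) ⟩
    zipWith _*_ (map s (downFrom (suc m))) (map s (upTo (suc m)))
      ≡⟨ List.zipWith-comm _*_ ℚ.*-comm (map s (downFrom (suc m))) (map s (upTo (suc m))) ⟩
    zipWith _*_ (map s (upTo (suc m))) (map s (downFrom (suc m)))
      ≡⟨ zipWith-upTo-downFrom s s m ⟩
    map (λ i → s i * s (m ℕ.∸ i)) (upTo (suc m))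
      ∎)
    where open ≡-Reasoning

  -- `sqrtRev` cuts off s₀ with a local copy of `dropLast` that cannot be named from here. After
  -- abstracting the list and `zipWith _*_`, unification instantiates ι below with that copy.
  agrees-with-dropLast : {ι : List ℚ → List ℚ} → ι [] ≡ [] → (∀ x → ι (x ∷ []) ≡ []) →
    (∀ x y ys → ι (x ∷ y ∷ ys) ≡ x ∷ ι (y ∷ ys)) → ∀ xs → ι xs ≡ dropLast xs
  agrees-with-dropLast ι-nil ι-single ι-cons []           = ι-nil
  agrees-with-dropLast ι-nil ι-single ι-cons (x ∷ [])     = ι-single x
  agrees-with-dropLast {ι} ι-nil ι-single ι-cons (x ∷ y ∷ ys) =
    trans (ι-cons x y ys) (cong (x ∷_) (agrees-with-dropLast {ι} ι-nil ι-single ι-cons (y ∷ ys)))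

  sqrtS-coeff-dropLast : (f : Series) (m : ℕ) → let xs = dropLast (sqrtRev f (suc m)) in
    sqrtS f (2 ℕ.+ m) ≡ ½ * (f (2 ℕ.+ m) - qsum (zipWith _*_ xs (reverse xs)))
  sqrtS-coeff-dropLast f m with agrees-with-dropLast refl (λ _ → refl) (λ _ _ _ → refl)
  ... | ι≗dropLast with sqrtRev f (suc m)
  ... | M with zipWith {A = ℚ} {B = ℚ} {C = ℚ} _*_
  ... | z = cong (λ xs → ½ * (f (2 ℕ.+ m) - qsum (z xs (reverse xs)))) (ι≗dropLast M)

  sqrtS-coeff-suc-suc : (f : Series) (m : ℕ) →
    sqrtS f (2 ℕ.+ m) ≡ ½ * (f (2 ℕ.+ m) - (divZ (sqrtS f) ⊛ divZ (sqrtS f)) m)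
  sqrtS-coeff-suc-suc f m = trans (sqrtS-coeff-dropLast f m) (cong (λ c → ½ * (f (2 ℕ.+ m) - c)) (begin
    qsum (zipWith _*_ (dropLast (sqrtRev f (suc m))) (reverse (dropLast (sqrtRev f (suc m)))))
      ≡⟨ cong (λ xs → qsum (zipWith _*_ (dropLast xs) (reverse (dropLast xs)))) (sqrtRev-downFrom f (suc m)) ⟩
    qsum (zipWith _*_ (dropLast (map s (downFrom (2 ℕ.+ m)))) (reverse (dropLast (map s (downFrom (2 ℕ.+ m))))))
      ≡⟨ cong (λ xs → qsum (zipWith _*_ xs (reverse xs))) (dropLast-downFrom s m) ⟩
    qsum (zipWith _*_ (map (divZ s) (downFrom (suc m))) (reverse (map (divZ s) (downFrom (suc m)))))
      ≡⟨ qsum-zipWith-reverse (divZ s) m ⟩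
    (divZ s ⊛ divZ s) m
      ∎))
    where
    open ≡-Reasoning
    s = sqrtS f

  sqrtS-square : (f : Series) → f 0 ≡ 1ℚ → sqrtS f ⊛ sqrtS f ≐ f
  sqrtS-square f f₀≡1 zero = trans (⊛-coeff-zero (sqrtS f) (sqrtS f)) (sym f₀≡1)
  sqrtS-square f f₀≡1 (suc zero) = begin
    (s ⊛ s) 1                                    ≡⟨ ⊛-coeff-suc s s 0 ⟩
    1ℚ * (½ * (f 1 - 0ℚ)) + (divZ s ⊛ s) 0       ≡⟨ cong (1ℚ * (½ * (f 1 - 0ℚ)) +_) (⊛-coeff-zero (divZ s) s) ⟩
    1ℚ * (½ * (f 1 - 0ℚ)) + ½ * (f 1 - 0ℚ) * 1ℚ  ≡⟨ halves (f 1) ⟩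
    f 1                                          ∎
    where
    open ≡-Reasoning
    open +-*-Solver
    s = sqrtS f
    halves : (a : ℚ) → 1ℚ * (½ * (a - 0ℚ)) + ½ * (a - 0ℚ) * 1ℚ ≡ a
    halves = solve 1 (λ a → con 1ℚ :* (con ½ :* (a :- con 0ℚ)) :+ con ½ :* (a :- con 0ℚ) :* con 1ℚ := a) refl
  sqrtS-square f f₀≡1 (suc (suc m)) = begin
    (s ⊛ s) (2 ℕ.+ m)                         ≡⟨ ⊛-coeff-suc s s (suc m) ⟩
    1ℚ * s (2 ℕ.+ m) + (divZ s ⊛ s) (suc m)   ≡⟨ cong (1ℚ * s (2 ℕ.+ m) +_) (⊛-coeff-sucʳ (divZ s) s m) ⟩
    1ℚ * s (2 ℕ.+ m) + (c + s (2 ℕ.+ m) * 1ℚ) ≡⟨ cong (λ x → 1ℚ * x + (c + x * 1ℚ)) (sqrtS-coeff-suc-suc f m) ⟩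
    1ℚ * σ + (c + σ * 1ℚ)                     ≡⟨ halves (f (2 ℕ.+ m)) c ⟩
    f (2 ℕ.+ m)                               ∎
    where
    open ≡-Reasoning
    open +-*-Solver
    s = sqrtS f
    c = (divZ s ⊛ divZ s) m
    σ = ½ * (f (2 ℕ.+ m) - c)
    halves : (a c : ℚ) → 1ℚ * (½ * (a - c)) + (c + ½ * (a - c) * 1ℚ) ≡ a
    halves = solve 2 (λ a c → con 1ℚ :* (con ½ :* (a :- c)) :+ (c :+ con ½ :* (a :- c) :* con 1ℚ) := a) refl

  -- An identity f ≐ g is derived from a relation l ≐ r by checking f + c r = g + c l as
  -- polynomials in the atoms, i.e. by exhibiting f − g as a multiple of l − r.
  ≐-by-relation : {f g l r : Series} (c : Series) → l ≐ r → f ⊕ c ⊛ r ≐ g ⊕ c ⊛ l → f ≐ g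
  ≐-by-relation {f} {g} {l} {r} c l≐r f+cr≐g+cl =
    ∙-cancelʳ (c ⊛ r) f g (≐-trans f+cr≐g+cl (⊕-cong (≐-refl {g}) (⊛-congʳ c l≐r)))
    where open GroupProperties (CommutativeRing.+-group seriesCommutativeRing) using (∙-cancelʳ)

  ℚn≡mkℚ : (n : ℕ) → ℚn n ≡ mkℚ (ℤ.+ n) 0 (Coprimality.sym (Coprimality.1-coprimeTo n))
  ℚn≡mkℚ n = ℚ.normalize-coprime (Coprimality.sym (Coprimality.1-coprimeTo n))

  ℚn-+ : (m n : ℕ) → ℚn (m ℕ.+ n) ≡ ℚn m + ℚn n
  ℚn-+ m n = sym (begin
    ℚn m + ℚn n
      ≡⟨ cong₂ _+_ (ℚn≡mkℚ m) (ℚn≡mkℚ n) ⟩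
    (ℤ.+ m ℤ.* ℤ.+ 1 ℤ.+ ℤ.+ n ℤ.* ℤ.+ 1) / 1
      ≡⟨ cong (_/ 1) (cong₂ ℤ._+_ (ℤ.*-identityʳ (ℤ.+ m)) (ℤ.*-identityʳ (ℤ.+ n))) ⟩
    ℚn (m ℕ.+ n)
      ∎)
    where open ≡-Reasoning

  qsum-map-ℚn : (ns : List ℕ) → qsum (map ℚn ns) ≡ ℚn (sum ns)
  qsum-map-ℚn []       = refl
  qsum-map-ℚn (n ∷ ns) = trans (cong (ℚn n +_) (qsum-map-ℚn ns)) (sym (ℚn-+ n (sum ns)))

  ⨁ : List Series → Series
  ⨁ = foldr _⊕_ 0ₛ

  ⨁-coeff : (fs : List Series) (n : ℕ) → ⨁ fs n ≡ qsum (map (λ f → f n) fs)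
  ⨁-coeff []       n = 0ₛ-coeff n
  ⨁-coeff (f ∷ fs) n = cong (f n +_) (⨁-coeff fs n)

  module _ {S : Set} (predecessors : S → List S) where

    transfer-coefficients : (N : S → ℕ → ℕ) (F : S → Series) →
      (∀ q n → N q (suc n) ≡ sum (map (λ p → N p n) (predecessors q))) →
      (∀ q → F q ≐ const (ℚn (N q 0)) ⊕ X ⊛ ⨁ (map F (predecessors q))) →
      ∀ n q → F q n ≡ ℚn (N q n)
    transfer-coefficients N F N-suc F-transfer zero q = begin
      F q 0                                            ≡⟨ F-transfer q 0 ⟩
      ℚn (N q 0) + (X ⊛ ⨁ (map F (predecessors q))) 0  ≡⟨ cong (ℚn (N q 0) +_) (X⊛-coeff-zero (⨁ (map F (predecessors q)))) ⟩
      ℚn (N q 0) + 0ℚ                                  ≡⟨ ℚ.+-identityʳ _ ⟩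
      ℚn (N q 0)                                       ∎
      where open ≡-Reasoning
    transfer-coefficients N F N-suc F-transfer (suc n) q = begin
      F q (suc n)                                         ≡⟨ F-transfer q (suc n) ⟩
      0ℚ + (X ⊛ ⨁ (map F (predecessors q))) (suc n)      ≡⟨ ℚ.+-identityˡ _ ⟩
      (X ⊛ ⨁ (map F (predecessors q))) (suc n)           ≡⟨ X⊛-coeff-suc (⨁ (map F (predecessors q))) n ⟩
      ⨁ (map F (predecessors q)) n                        ≡⟨ ⨁-coeff (map F (predecessors q)) n ⟩
      qsum (map (λ f → f n) (map F (predecessors q)))     ≡⟨ cong qsum (List.map-∘ (predecessors q)) ⟨
      qsum (map (λ p → F p n) (predecessors q))           ≡⟨ cong qsum (List.map-cong induction (predecessors q)) ⟩
      qsum (map (λ p → ℚn (N p n)) (predecessors q))      ≡⟨ cong qsum (List.map-∘ (predecessors q)) ⟩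
      qsum (map ℚn (map (λ p → N p n) (predecessors q)))  ≡⟨ qsum-map-ℚn (map (λ p → N p n) (predecessors q)) ⟩
      ℚn (sum (map (λ p → N p n) (predecessors q)))       ≡⟨ cong ℚn (N-suc q n) ⟨
      ℚn (N q (suc n))                                    ∎
      where
      open ≡-Reasoning
      induction : ∀ p → F p n ≡ ℚn (N p n)
      induction = transfer-coefficients N F N-suc F-transfer n

module Automaton where

  open import Data.Bool using (Bool; true; false; _∧_; not; if_then_else_)
  import Data.Bool.Properties as Bool
  import Data.Integer as ℤ
  import Data.Integer.Properties as ℤ
  open import Data.List using (List; []; _∷_; foldl)
  open import Data.Maybe using (Maybe; just; nothing)
  open import Data.Nat using (_≡ᵇ_)
  open import Relation.Binary.PropositionalEquality using (cong₂; module ≡-Reasoning)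

  -- `lastU 0` is also the empty path; the flag of `lastD`/`lastR` is true when the final run
  -- of down-steps has odd length.
  data State : Set where
    lastU       : ℕ → State
    lastD lastR : Bool → ℕ → State

  step : State → Step → Maybe State
  step (lastU h)           U = just (lastU (suc h))
  step (lastU zero)        D = nothing
  step (lastU (suc h))     D = just (lastD true h)
  step (lastU h)           R = nothing
  step (lastD odd zero)    U = if odd then just (lastU 1) else nothing
  step (lastD odd (suc h)) U = just (lastU (suc (suc h)))
  step (lastD odd zero)    D = nothing
  step (lastD odd (suc h)) D = just (lastD (not odd) h)
  step (lastD odd zero)    R = nothing
  step (lastD odd (suc h)) R = just (lastR (not odd) h)
  step (lastR odd h)       U = nothing
  step (lastR odd zero)    D = nothing
  step (lastR odd (suc h)) D = just (lastD (not odd) h)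
  step (lastR odd zero)    R = nothing
  step (lastR odd (suc h)) R = just (lastR (not odd) h)

  advance : Maybe State → Step → Maybe State
  advance nothing  t = nothing
  advance (just q) t = step q t

  runFrom : Maybe State → List Step → Maybe State
  runFrom = foldl advance

  _==_ : State → State → Bool
  lastU h       == lastU k       = h ≡ᵇ k
  lastD true h  == lastD true k  = h ≡ᵇ k
  lastD false h == lastD false k = h ≡ᵇ k
  lastR true h  == lastR true k  = h ≡ᵇ k
  lastR false h == lastR false k = h ≡ᵇ k
  _             == _             = false

  _∋_ : Maybe State → State → Bool
  nothing ∋ q = false
  just p  ∋ q = p == q

  height : State → ℕ
  height (lastU h)   = h
  height (lastD _ h) = h
  height (lastR _ h) = h

  lastStep : State → Step
  lastStep (lastU _)   = U
  lastStep (lastD _ _) = D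
  lastStep (lastR _ _) = R

  -- Some run length of the parity recorded in the state: `scan` only sees that parity.
  runLength : State → ℕ
  runLength (lastU _)       = 0
  runLength (lastD true _)  = 1
  runLength (lastD false _) = 2
  runLength (lastR true _)  = 1
  runLength (lastR false _) = 2

  atLevel : ℕ → ℤ.ℤ → List Step → Bool
  atLevel k z w = ℤeqB (endHeight w ℤ.+ z) (ℤ.+ k)

  admissibleFrom : State → List Step → Bool
  admissibleFrom q w = scan (height q) (runLength q) w ∧ noUR-RU (lastStep q ∷ w) ∧ lastIsU (lastStep q ∷ w)

  accepts : ℕ → State → List Step → Bool
  accepts k q w = admissibleFrom q w ∧ atLevel k (ℤ.+ height q) w

  acceptsFrom : ℕ → Maybe State → List Step → Bool
  acceptsFrom k nothing  w = false
  acceptsFrom k (just q) w = accepts k q w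

  atLevel-∷ : (k : ℕ) (z : ℤ.ℤ) (t : Step) (v : List Step) → atLevel k z (t ∷ v) ≡ atLevel k (stepHeight t ℤ.+ z) v
  atLevel-∷ k z t v = cong (λ e → ℤeqB e (ℤ.+ k))
    (trans (cong (ℤ._+ z) (ℤ.+-comm (stepHeight t) (endHeight v))) (ℤ.+-assoc (endHeight v) (stepHeight t) z))

  runOK-parity : (h r : ℕ) → runOK h (suc (suc (suc r))) ≡ runOK h (suc r)
  runOK-parity zero    r = Bool.not-involutive (oddB (suc r))
  runOK-parity (suc h) r = refl

  scan-parity : (h r : ℕ) (w : List Step) → scan h (suc (suc (suc r))) w ≡ scan h (suc r) w
  scan-parity h       r []      = runOK-parity h r
  scan-parity h       r (U ∷ w) = cong (_∧ scan (suc h) 0 w) (runOK-parity h r)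
  scan-parity zero    r (D ∷ w) = refl
  scan-parity (suc h) r (D ∷ w) = scan-parity h (suc r) w
  scan-parity zero    r (R ∷ w) = refl
  scan-parity (suc h) r (R ∷ w) = scan-parity h (suc r) w

  accepts-step : (k : ℕ) (q : State) (t : Step) (v : List Step) (q′ : State) →
    admissibleFrom q (t ∷ v) ≡ admissibleFrom q′ v → stepHeight t ℤ.+ ℤ.+ height q ≡ ℤ.+ height q′ →
    accepts k q (t ∷ v) ≡ accepts k q′ v
  accepts-step k q t v q′ admissible≡ height≡ =
    cong₂ _∧_ admissible≡ (trans (atLevel-∷ k (ℤ.+ height q) t v) (cong (λ z → atLevel k z v) height≡))

  accepts-forbidden : (k : ℕ) (q : State) (t : Step) (v : List Step) → noUR-RU (lastStep q ∷ t ∷ v) ≡ false →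
    accepts k q (t ∷ v) ≡ false
  accepts-forbidden k q t v forbidden = cong (_∧ atLevel k (ℤ.+ height q) (t ∷ v)) (begin
    scan (height q) (runLength q) (t ∷ v) ∧ noUR-RU (lastStep q ∷ t ∷ v) ∧ lastIsU (lastStep q ∷ t ∷ v)
      ≡⟨ cong (λ b → scan (height q) (runLength q) (t ∷ v) ∧ b ∧ lastIsU (lastStep q ∷ t ∷ v)) forbidden ⟩
    scan (height q) (runLength q) (t ∷ v) ∧ false
      ≡⟨ Bool.∧-zeroʳ _ ⟩
    false
      ∎)
    where open ≡-Reasoning

  accepts-∷ : (k : ℕ) (q : State) (t : Step) (v : List Step) → accepts k q (t ∷ v) ≡ acceptsFrom k (step q t) v
  accepts-∷ k q@(lastU h)             U v = accepts-step k q U v (lastU (suc h)) refl refl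
  accepts-∷ k (lastU zero)            D v = refl
  accepts-∷ k q@(lastU (suc h))       D v = accepts-step k q D v (lastD true h) refl refl
  accepts-∷ k (lastU zero)            R v = refl
  accepts-∷ k q@(lastU (suc h))       R v = accepts-forbidden k q R v refl
  accepts-∷ k q@(lastD true zero)     U v = accepts-step k q U v (lastU 1) refl refl
  accepts-∷ k (lastD false zero)      U v = refl
  accepts-∷ k q@(lastD true (suc h))  U v = accepts-step k q U v (lastU (suc (suc h))) refl refl
  accepts-∷ k q@(lastD false (suc h)) U v = accepts-step k q U v (lastU (suc (suc h))) refl refl
  accepts-∷ k (lastD odd zero)        D v = refl
  accepts-∷ k q@(lastD true (suc h))  D v = accepts-step k q D v (lastD false h) refl refl
  accepts-∷ k q@(lastD false (suc h)) D v = accepts-step k q D v (lastD true h) (cong₂ _∧_ (scan-parity h 0 v) refl) refl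
  accepts-∷ k (lastD odd zero)        R v = refl
  accepts-∷ k q@(lastD true (suc h))  R v = accepts-step k q R v (lastR false h) refl refl
  accepts-∷ k q@(lastD false (suc h)) R v = accepts-step k q R v (lastR true h) (cong₂ _∧_ (scan-parity h 0 v) refl) refl
  accepts-∷ k q@(lastR odd h)         U v = accepts-forbidden k q U v refl
  accepts-∷ k (lastR odd zero)        D v = refl
  accepts-∷ k q@(lastR true (suc h))  D v = accepts-step k q D v (lastD false h) refl refl
  accepts-∷ k q@(lastR false (suc h)) D v = accepts-step k q D v (lastD true h) (cong₂ _∧_ (scan-parity h 0 v) refl) refl
  accepts-∷ k (lastR odd zero)        R v = refl
  accepts-∷ k q@(lastR true (suc h))  R v = accepts-step k q R v (lastR false h) refl refl
  accepts-∷ k q@(lastR false (suc h)) R v = accepts-step k q R v (lastR true h) (cong₂ _∧_ (scan-parity h 0 v) refl) refl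

  accepts-[] : (k : ℕ) (q : State) → accepts k q [] ≡ just q ∋ lastU k
  accepts-[] k (lastU h)             = refl
  accepts-[] k (lastD true zero)     = refl
  accepts-[] k (lastD false zero)    = refl
  accepts-[] k (lastD true (suc h))  = refl
  accepts-[] k (lastD false (suc h)) = refl
  accepts-[] k (lastR true zero)     = refl
  accepts-[] k (lastR false zero)    = refl
  accepts-[] k (lastR true (suc h))  = refl
  accepts-[] k (lastR false (suc h)) = refl

  runFrom-nothing : (w : List Step) → runFrom nothing w ≡ nothing
  runFrom-nothing []      = refl
  runFrom-nothing (t ∷ w) = runFrom-nothing w

  acceptsFrom-runFrom : (k : ℕ) (m : Maybe State) (w : List Step) → acceptsFrom k m w ≡ runFrom m w ∋ lastU k
  acceptsFrom-runFrom k nothing  w       = cong (_∋ lastU k) (sym (runFrom-nothing w))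
  acceptsFrom-runFrom k (just q) []      = accepts-[] k q
  acceptsFrom-runFrom k (just q) (t ∷ w) = trans (accepts-∷ k q t w) (acceptsFrom-runFrom k (step q t) w)

  ∧-rearrange : (a b c z : Bool) → (a ∧ b) ∧ (z ∧ c) ≡ (a ∧ b ∧ c) ∧ z
  ∧-rearrange false b    c z = refl
  ∧-rearrange true false c z = refl
  ∧-rearrange true true  c z = Bool.∧-comm z c

  -- The empty path counts as ending with U; prefixing U changes no other check, since a path
  -- starting with R is rejected by `scan` anyway.
  countedByG-accepts : (k : ℕ) (w : List Step) → countedByG k w ≡ accepts k (lastU 0) w
  countedByG-accepts k []      = Bool.∧-identityʳ (0 ≡ᵇ k)
  countedByG-accepts k (U ∷ v) = trans
    (∧-rearrange (scan 1 0 v) (noUR-RU (U ∷ v)) (lastIsU (U ∷ v)) (ℤeqB (endHeight (U ∷ v)) (ℤ.+ k)))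
    (cong (λ e → (scan 1 0 v ∧ noUR-RU (U ∷ v) ∧ lastIsU (U ∷ v)) ∧ ℤeqB e (ℤ.+ k))
          (sym (ℤ.+-identityʳ (endHeight (U ∷ v)))))
  countedByG-accepts k (D ∷ v) = refl
  countedByG-accepts k (R ∷ v) = refl

  countedByG-runFrom : (k : ℕ) (w : List Step) → countedByG k w ≡ runFrom (just (lastU 0)) w ∋ lastU k
  countedByG-runFrom k w = trans (countedByG-accepts k w) (acceptsFrom-runFrom k (just (lastU 0)) w)

module WordCounts where

  open Automaton
  open import Data.Bool using (Bool; true; false)
  open import Data.Bool.Properties using (T?)
  open import Data.List using (List; []; _∷_; map; _∷ʳ_; length; filter; concatMap)
  import Data.List.Properties as List
  open import Data.Maybe using (Maybe; just; nothing)
  open import Data.Nat using (_+_)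
  import Data.Nat.Properties as ℕ
  open import Data.Nat.ListAction using (sum)
  open import Data.Nat.Solver using (module +-*-Solver)
  open import Algebra.Properties.CommutativeSemigroup ℕ.+-commutativeSemigroup
    using () renaming (interchange to +-interchange)
  open import Relation.Binary.PropositionalEquality using (cong₂; module ≡-Reasoning)

  indicator : Bool → ℕ
  indicator true  = 1
  indicator false = 0

  steps : List Step
  steps = U ∷ D ∷ R ∷ []

  Σwords : ℕ → (List Step → ℕ) → ℕ
  Σwords zero    f = f []
  Σwords (suc n) f = Σwords n (λ w → f (U ∷ w)) + Σwords n (λ w → f (D ∷ w)) + Σwords n (λ w → f (R ∷ w))

  Σwords-cong : {f g : List Step → ℕ} (n : ℕ) → (∀ w → f w ≡ g w) → Σwords n f ≡ Σwords n g
  Σwords-cong zero    f≗g = f≗g []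
  Σwords-cong (suc n) f≗g = cong₂ _+_
    (cong₂ _+_ (Σwords-cong n (λ w → f≗g (U ∷ w))) (Σwords-cong n (λ w → f≗g (D ∷ w))))
    (Σwords-cong n (λ w → f≗g (R ∷ w)))

  Σwords-+ : (n : ℕ) (f g : List Step → ℕ) → Σwords n (λ w → f w + g w) ≡ Σwords n f + Σwords n g
  Σwords-+ zero    f g = refl
  Σwords-+ (suc n) f g = begin
    Σwords n (λ w → f (U ∷ w) + g (U ∷ w)) + Σwords n (λ w → f (D ∷ w) + g (D ∷ w))
      + Σwords n (λ w → f (R ∷ w) + g (R ∷ w))
      ≡⟨ cong₂ _+_ (cong₂ _+_ (Σwords-+ n _ _) (Σwords-+ n _ _)) (Σwords-+ n _ _) ⟩
    (fU + gU) + (fD + gD) + (fR + gR)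
      ≡⟨ cong (_+ (fR + gR)) (+-interchange fU gU fD gD) ⟩
    (fU + fD) + (gU + gD) + (fR + gR)
      ≡⟨ +-interchange (fU + fD) (gU + gD) fR gR ⟩
    (fU + fD + fR) + (gU + gD + gR)
      ∎
    where
    open ≡-Reasoning
    fU = Σwords n (λ w → f (U ∷ w))
    fD = Σwords n (λ w → f (D ∷ w))
    fR = Σwords n (λ w → f (R ∷ w))
    gU = Σwords n (λ w → g (U ∷ w))
    gD = Σwords n (λ w → g (D ∷ w))
    gR = Σwords n (λ w → g (R ∷ w))

  Σwords-zero : (n : ℕ) → Σwords n (λ _ → 0) ≡ 0
  Σwords-zero zero    = refl
  Σwords-zero (suc n) = cong₂ _+_ (cong₂ _+_ (Σwords-zero n) (Σwords-zero n)) (Σwords-zero n)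

  Σwords-sum : {A : Set} (n : ℕ) (g : A → List Step → ℕ) (xs : List A) →
    Σwords n (λ w → sum (map (λ a → g a w) xs)) ≡ sum (map (λ a → Σwords n (g a)) xs)
  Σwords-sum n g []       = Σwords-zero n
  Σwords-sum n g (x ∷ xs) = trans (Σwords-+ n (g x) _) (cong (Σwords n (g x) +_) (Σwords-sum n g xs))

  Σwords-∷ʳ : (n : ℕ) (f : List Step → ℕ) → Σwords (suc n) f ≡ Σwords n (λ w → sum (map (λ t → f (w ∷ʳ t)) steps))
  Σwords-∷ʳ zero    f = begin
    f (U ∷ []) + f (D ∷ []) + f (R ∷ [])          ≡⟨ ℕ.+-assoc (f (U ∷ [])) _ _ ⟩
    f (U ∷ []) + (f (D ∷ []) + f (R ∷ []))        ≡⟨ cong (λ x → f (U ∷ []) + (f (D ∷ []) + x)) (ℕ.+-identityʳ _) ⟨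
    f (U ∷ []) + (f (D ∷ []) + (f (R ∷ []) + 0))  ∎
    where open ≡-Reasoning
  Σwords-∷ʳ (suc n) f = cong₂ _+_
    (cong₂ _+_ (Σwords-∷ʳ n (λ w → f (U ∷ w))) (Σwords-∷ʳ n (λ w → f (D ∷ w))))
    (Σwords-∷ʳ n (λ w → f (R ∷ w)))

  count-filter : (P : List Step → Bool) (ws : List (List Step)) →
    length (filter (λ w → T? (P w)) ws) ≡ sum (map (λ w → indicator (P w)) ws)
  count-filter P []       = refl
  count-filter P (w ∷ ws) with P w
  ... | true  = cong suc (count-filter P ws)
  ... | false = count-filter P ws

  sum-map-extend : (f : List Step → ℕ) (ws : List (List Step)) →
    sum (map f (concatMap (λ w → (U ∷ w) ∷ (D ∷ w) ∷ (R ∷ w) ∷ []) ws))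
      ≡ sum (map (λ w → f (U ∷ w)) ws) + sum (map (λ w → f (D ∷ w)) ws) + sum (map (λ w → f (R ∷ w)) ws)
  sum-map-extend f []       = refl
  sum-map-extend f (w ∷ ws) =
    trans (cong (λ s → f (U ∷ w) + (f (D ∷ w) + (f (R ∷ w) + s))) (sum-map-extend f ws))
          (shuffle (f (U ∷ w)) (f (D ∷ w)) (f (R ∷ w)) _ _ _)
    where
    open +-*-Solver
    shuffle : (a b c x y z : ℕ) → a + (b + (c + (x + y + z))) ≡ (a + x) + (b + y) + (c + z)
    shuffle = solve 6 (λ a b c x y z → a :+ (b :+ (c :+ (x :+ y :+ z))) := (a :+ x) :+ (b :+ y) :+ (c :+ z)) refl

  sum-map-words : (n : ℕ) (f : List Step → ℕ) → sum (map f (words n)) ≡ Σwords n f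
  sum-map-words zero    f = ℕ.+-identityʳ (f [])
  sum-map-words (suc n) f = trans (sum-map-extend f (words n))
    (cong₂ _+_ (cong₂ _+_ (sum-map-words n _) (sum-map-words n _)) (sum-map-words n _))

  predecessors : State → List State
  predecessors (lastU zero)          = []
  predecessors (lastU (suc zero))    = lastU 0 ∷ lastD true 0 ∷ []
  predecessors (lastU (suc (suc h))) = lastU (suc h) ∷ lastD false (suc h) ∷ lastD true (suc h) ∷ []
  predecessors (lastD true h)        = lastU (suc h) ∷ lastD false (suc h) ∷ lastR false (suc h) ∷ []
  predecessors (lastD false h)       = lastD true (suc h) ∷ lastR true (suc h) ∷ []
  predecessors (lastR true h)        = lastD false (suc h) ∷ lastR false (suc h) ∷ []
  predecessors (lastR false h)       = lastD true (suc h) ∷ lastR true (suc h) ∷ []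

  sum-map-zero : {A : Set} (xs : List A) → 0 ≡ sum (map (λ _ → 0) xs)
  sum-map-zero []       = refl
  sum-map-zero (x ∷ xs) = sum-map-zero xs

  -- A finite check by computation. Both sides are sums over lists, so where the height
  -- comparison stays undecided they reduce to the same term `indicator (k ≡ᵇ h) + 0`.
  predecessors-complete : (m : Maybe State) (q : State) →
    sum (map (λ t → indicator (advance m t ∋ q)) steps) ≡ sum (map (λ p → indicator (m ∋ p)) (predecessors q))
  predecessors-complete nothing q = sum-map-zero (predecessors q)
  predecessors-complete (just (lastU zero)         ) (lastU zero)          = refl
  predecessors-complete (just (lastU (suc k))      ) (lastU zero)          = refl
  predecessors-complete (just (lastD true zero)    ) (lastU zero)          = refl
  predecessors-complete (just (lastD true (suc k)) ) (lastU zero)          = refl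
  predecessors-complete (just (lastD false zero)   ) (lastU zero)          = refl
  predecessors-complete (just (lastD false (suc k))) (lastU zero)          = refl
  predecessors-complete (just (lastR true zero)    ) (lastU zero)          = refl
  predecessors-complete (just (lastR true (suc k)) ) (lastU zero)          = refl
  predecessors-complete (just (lastR false zero)   ) (lastU zero)          = refl
  predecessors-complete (just (lastR false (suc k))) (lastU zero)          = refl
  predecessors-complete (just (lastU zero)         ) (lastU (suc zero))    = refl
  predecessors-complete (just (lastU (suc k))      ) (lastU (suc zero))    = refl
  predecessors-complete (just (lastD true zero)    ) (lastU (suc zero))    = refl
  predecessors-complete (just (lastD true (suc k)) ) (lastU (suc zero))    = refl
  predecessors-complete (just (lastD false zero)   ) (lastU (suc zero))    = refl
  predecessors-complete (just (lastD false (suc k))) (lastU (suc zero))    = refl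
  predecessors-complete (just (lastR true zero)    ) (lastU (suc zero))    = refl
  predecessors-complete (just (lastR true (suc k)) ) (lastU (suc zero))    = refl
  predecessors-complete (just (lastR false zero)   ) (lastU (suc zero))    = refl
  predecessors-complete (just (lastR false (suc k))) (lastU (suc zero))    = refl
  predecessors-complete (just (lastU zero)         ) (lastU (suc (suc h))) = refl
  predecessors-complete (just (lastU (suc k))      ) (lastU (suc (suc h))) = refl
  predecessors-complete (just (lastD true zero)    ) (lastU (suc (suc h))) = refl
  predecessors-complete (just (lastD true (suc k)) ) (lastU (suc (suc h))) = refl
  predecessors-complete (just (lastD false zero)   ) (lastU (suc (suc h))) = refl
  predecessors-complete (just (lastD false (suc k))) (lastU (suc (suc h))) = refl
  predecessors-complete (just (lastR true zero)    ) (lastU (suc (suc h))) = refl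
  predecessors-complete (just (lastR true (suc k)) ) (lastU (suc (suc h))) = refl
  predecessors-complete (just (lastR false zero)   ) (lastU (suc (suc h))) = refl
  predecessors-complete (just (lastR false (suc k))) (lastU (suc (suc h))) = refl
  predecessors-complete (just (lastU zero)         ) (lastD true h)        = refl
  predecessors-complete (just (lastU (suc k))      ) (lastD true h)        = refl
  predecessors-complete (just (lastD true zero)    ) (lastD true h)        = refl
  predecessors-complete (just (lastD true (suc k)) ) (lastD true h)        = refl
  predecessors-complete (just (lastD false zero)   ) (lastD true h)        = refl
  predecessors-complete (just (lastD false (suc k))) (lastD true h)        = refl
  predecessors-complete (just (lastR true zero)    ) (lastD true h)        = refl
  predecessors-complete (just (lastR true (suc k)) ) (lastD true h)        = refl
  predecessors-complete (just (lastR false zero)   ) (lastD true h)        = refl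
  predecessors-complete (just (lastR false (suc k))) (lastD true h)        = refl
  predecessors-complete (just (lastU zero)         ) (lastD false h)       = refl
  predecessors-complete (just (lastU (suc k))      ) (lastD false h)       = refl
  predecessors-complete (just (lastD true zero)    ) (lastD false h)       = refl
  predecessors-complete (just (lastD true (suc k)) ) (lastD false h)       = refl
  predecessors-complete (just (lastD false zero)   ) (lastD false h)       = refl
  predecessors-complete (just (lastD false (suc k))) (lastD false h)       = refl
  predecessors-complete (just (lastR true zero)    ) (lastD false h)       = refl
  predecessors-complete (just (lastR true (suc k)) ) (lastD false h)       = refl
  predecessors-complete (just (lastR false zero)   ) (lastD false h)       = refl
  predecessors-complete (just (lastR false (suc k))) (lastD false h)       = refl
  predecessors-complete (just (lastU zero)         ) (lastR true h)        = refl
  predecessors-complete (just (lastU (suc k))      ) (lastR true h)        = refl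
  predecessors-complete (just (lastD true zero)    ) (lastR true h)        = refl
  predecessors-complete (just (lastD true (suc k)) ) (lastR true h)        = refl
  predecessors-complete (just (lastD false zero)   ) (lastR true h)        = refl
  predecessors-complete (just (lastD false (suc k))) (lastR true h)        = refl
  predecessors-complete (just (lastR true zero)    ) (lastR true h)        = refl
  predecessors-complete (just (lastR true (suc k)) ) (lastR true h)        = refl
  predecessors-complete (just (lastR false zero)   ) (lastR true h)        = refl
  predecessors-complete (just (lastR false (suc k))) (lastR true h)        = refl
  predecessors-complete (just (lastU zero)         ) (lastR false h)       = refl
  predecessors-complete (just (lastU (suc k))      ) (lastR false h)       = refl
  predecessors-complete (just (lastD true zero)    ) (lastR false h)       = refl
  predecessors-complete (just (lastD true (suc k)) ) (lastR false h)       = refl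
  predecessors-complete (just (lastD false zero)   ) (lastR false h)       = refl
  predecessors-complete (just (lastD false (suc k))) (lastR false h)       = refl
  predecessors-complete (just (lastR true zero)    ) (lastR false h)       = refl
  predecessors-complete (just (lastR true (suc k)) ) (lastR false h)       = refl
  predecessors-complete (just (lastR false zero)   ) (lastR false h)       = refl
  predecessors-complete (just (lastR false (suc k))) (lastR false h)       = refl

  endCount : State → ℕ → ℕ
  endCount q n = Σwords n (λ w → indicator (runFrom (just (lastU 0)) w ∋ q))

  gCount-endCount : (k n : ℕ) → gCount k n ≡ endCount (lastU k) n
  gCount-endCount k n = begin
    length (filter (λ w → T? (countedByG k w)) (words n))   ≡⟨ count-filter (countedByG k) (words n) ⟩
    sum (map (λ w → indicator (countedByG k w)) (words n))  ≡⟨ sum-map-words n _ ⟩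
    Σwords n (λ w → indicator (countedByG k w))             ≡⟨ Σwords-cong n (λ w → cong indicator (countedByG-runFrom k w)) ⟩
    endCount (lastU k) n                                    ∎
    where open ≡-Reasoning

  endCount-suc : (q : State) (n : ℕ) → endCount q (suc n) ≡ sum (map (λ p → endCount p n) (predecessors q))
  endCount-suc q n = begin
    Σwords (suc n) (λ w → indicator (run w ∋ q))
      ≡⟨ Σwords-∷ʳ n (λ w → indicator (run w ∋ q)) ⟩
    Σwords n (λ w → sum (map (λ t → indicator (run (w ∷ʳ t) ∋ q)) steps))
      ≡⟨ Σwords-cong n (λ w → trans (cong sum (List.map-cong (λ t → cong (λ m → indicator (m ∋ q)) (run-∷ʳ w t)) steps))
                                    (predecessors-complete (run w) q)) ⟩
    Σwords n (λ w → sum (map (λ p → indicator (run w ∋ p)) (predecessors q)))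
      ≡⟨ Σwords-sum n (λ p w → indicator (run w ∋ p)) (predecessors q) ⟩
    sum (map (λ p → endCount p n) (predecessors q))
      ∎
    where
    open ≡-Reasoning
    run : List Step → Maybe State
    run = runFrom (just (lastU 0))
    run-∷ʳ : (w : List Step) (t : Step) → run (w ∷ʳ t) ≡ advance (run w) t
    run-∷ʳ w t = List.foldl-∷ʳ advance (just (lastU 0)) t w

module ClosedForms where

  open PowerSeries
  open Automaton using (State; lastU; lastD; lastR)
  open WordCounts using (predecessors; endCount)
  open import Data.Bool using (true; false)
  open import Data.List using (map)
  open import Data.Rational using (0ℚ; ½; NonZero; _*_; _-_)
  import Data.Rational.Properties as ℚ
  open import Relation.Binary.PropositionalEquality using (subst; module ≡-Reasoning)
  import Relation.Binary.Reasoning.Setoid as SetoidReasoning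
  open SeriesSolver using (Polynomial; solve; _:+_; _:-_; _:*_; _:^_; _:=_; con)

  1⊖X-multiple-coeff-zero : (f g : Series) → (1ₛ ⊖ f ⊛ (X ⊛ g)) 0 ≡ 1ℚ
  1⊖X-multiple-coeff-zero f g = begin
    1ℚ - (f ⊛ (X ⊛ g)) 0  ≡⟨ cong (λ x → 1ℚ - x) (⊛-coeff-zero f (X ⊛ g)) ⟩
    1ℚ - f 0 * (X ⊛ g) 0  ≡⟨ cong (λ x → 1ℚ - f 0 * x) (X⊛-coeff-zero g) ⟩
    1ℚ - f 0 * 0ℚ         ≡⟨ cong (λ x → 1ℚ - x) (ℚ.*-zeroʳ (f 0)) ⟩
    1ℚ                    ∎
    where open ≡-Reasoning

  1⊖X-multiple-nonZero : (f g : Series) → NonZero ((1ₛ ⊖ f ⊛ (X ⊛ g)) 0)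
  1⊖X-multiple-nonZero f g = subst NonZero (sym (1⊖X-multiple-coeff-zero f g)) _

  A B : Series
  A = r₂ ⊛ inv twoMinusZ2
  B = (const 1ℚ ⊕ const (ℚn 3) ⊛ Z2 ⊖ X ⊛ r₂) ⊛ inv onePlusZ2

  y : Series
  y = X ⊛ A

  1-2y 1-3y² 1-4y² : Series
  1-2y  = 1ₛ ⊖ const (ℚn 2) ⊛ y
  1-3y² = 1ₛ ⊖ const (ℚn 3) ⊛ y ⊛ y
  1-4y² = 1ₛ ⊖ const (ℚn 4) ⊛ y ⊛ y

  instance
    1-2y-nonZero : NonZero (1-2y 0)
    1-2y-nonZero = 1⊖X-multiple-nonZero (const (ℚn 2)) A

    1-4y²-nonZero : NonZero (1-4y² 0)
    1-4y²-nonZero = 1⊖X-multiple-nonZero (const (ℚn 4) ⊛ y) A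

  s σ ρ δ : Series
  s = y ⊛ inv 1-4y²
  σ = y ⊛ s
  ρ = const (ℚn 2) ⊛ (y ⊛ σ)
  δ = y ⊕ ρ

  A⊛twoMinusZ2≐r₂ : A ⊛ twoMinusZ2 ≐ r₂
  A⊛twoMinusZ2≐r₂ = ⊛-inv-⊛ r₂ twoMinusZ2

  s⊛1-4y²≐y : s ⊛ 1-4y² ≐ y
  s⊛1-4y²≐y = ⊛-inv-⊛ y 1-4y²

  B⊛onePlusZ2≐numerator : B ⊛ onePlusZ2 ≐ const 1ℚ ⊕ const (ℚn 3) ⊛ Z2 ⊖ X ⊛ (A ⊛ twoMinusZ2)
  B⊛onePlusZ2≐numerator = ≐-trans (⊛-inv-⊛ _ onePlusZ2)
    (⊖-cong (≐-refl {const 1ℚ ⊕ const (ℚn 3) ⊛ Z2}) (⊛-congʳ X (≐-sym A⊛twoMinusZ2≐r₂)))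

  -- Solver expressions that evaluate to the series above when z, a and s stand for X, A and s.
  module Syntax {n : ℕ} (z a : Polynomial n) where
    T′ O′ Δ′ y′ 1-2y′ 1-3y²′ 1-4y²′ : Polynomial n
    T′     = con (ℚn 2) :- z :^ 2
    O′     = con 1ℚ :+ z :^ 2
    Δ′     = con 1ℚ :- con (ℚn 6) :* z :^ 2 :+ con (ℚn 5) :* z :^ 4
    y′     = z :* a
    1-2y′  = con 1ℚ :- con (ℚn 2) :* y′
    1-3y²′ = con 1ℚ :- con (ℚn 3) :* y′ :* y′
    1-4y²′ = con 1ℚ :- con (ℚn 4) :* y′ :* y′

    σ′ ρ′ δ′ : Polynomial n → Polynomial n
    σ′ s = y′ :* s
    ρ′ s = con (ℚn 2) :* (y′ :* σ′ s)
    δ′ s = y′ :+ ρ′ s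

  √Δ : Series
  √Δ = 1ₛ ⊕ Z2 ⊖ X ⊛ (const (ℚn 2) ⊛ (A ⊛ twoMinusZ2))

  sqrtS-Δ : sqrtS Δ ≐ √Δ
  sqrtS-Δ = begin
    sqrtS Δ
      ≈⟨ solve 2 (λ z r → r := con 1ℚ :+ z :^ 2 :- (con 1ℚ :+ z :^ 2 :- r)) ≐-refl X (sqrtS Δ) ⟩
    1ₛ ⊕ Z2 ⊖ numerator
      ≈⟨ ⊖-cong (≐-refl {1ₛ ⊕ Z2}) (X⊛-divZ numerator refl) ⟩
    1ₛ ⊕ Z2 ⊖ X ⊛ divZ numerator
      ≈⟨ ⊖-cong (≐-refl {1ₛ ⊕ Z2}) (⊛-congʳ X (≐-trans twice-half (⊛-congʳ (const (ℚn 2)) r₂≐A⊛twoMinusZ2))) ⟩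
    √Δ
      ∎
    where
    open SetoidReasoning ≐-setoid
    numerator : Series
    numerator = const 1ℚ ⊕ Z2 ⊖ sqrtS Δ
    r₂≐A⊛twoMinusZ2 : r₂ ≐ A ⊛ twoMinusZ2
    r₂≐A⊛twoMinusZ2 = ≐-sym A⊛twoMinusZ2≐r₂
    twice-half : divZ numerator ≐ const (ℚn 2) ⊛ r₂
    twice-half = solve 1 (λ d → d := con (ℚn 2) :* (con ½ :* d)) ≐-refl (divZ numerator)

  A-quadratic : A ⊛ 1-2y ≐ X ⊛ (1ₛ ⊖ y ⊖ y ⊛ y)
  A-quadratic = ⊛-cancelʳ (const (ℚn 4) ⊛ twoMinusZ2) (X⊛-cancel (≐-by-relation 1ₛ Δ≐√Δ²
    (solve 2 (λ z a → let open Syntax z a; √Δ′ = O′ :- z :* (con (ℚn 2) :* (a :* T′)) in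
        z :* (a :* 1-2y′ :* (con (ℚn 4) :* T′)) :+ con 1ℚ :* (√Δ′ :* √Δ′)
      := z :* (z :* (con 1ℚ :- y′ :- y′ :* y′) :* (con (ℚn 4) :* T′)) :+ con 1ℚ :* Δ′)
      ≐-refl X A)))
    where
    Δ≐√Δ² : Δ ≐ √Δ ⊛ √Δ
    Δ≐√Δ² = ≐-trans (≐-sym (sqrtS-square Δ refl)) (⊛-cong sqrtS-Δ sqrtS-Δ)

  A-fixpoint : A ≐ X ⊛ (1ₛ ⊕ σ ⊕ δ)
  A-fixpoint = ⊛-cancelʳ 1-2y (≐-by-relation 1ₛ A-quadratic (≐-by-relation (X ⊛ y) (≐-sym s⊛1-4y²≐y)
    (solve 3 (λ z a s → let open Syntax z a in
        a :* 1-2y′ :+ con 1ℚ :* (z :* (con 1ℚ :- y′ :- y′ :* y′)) :+ z :* y′ :* (s :* 1-4y²′)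
      := z :* (con 1ℚ :+ σ′ s :+ δ′ s) :* 1-2y′ :+ con 1ℚ :* (a :* 1-2y′) :+ z :* y′ :* y′)
      ≐-refl X A s)))

  B-quadratic : B ⊛ 1-3y² ≐ 1-4y²
  B-quadratic = ⊛-cancelʳ onePlusZ2 (≐-by-relation 1-3y² B⊛onePlusZ2≐numerator
    (≐-by-relation (X ⊛ (const (ℚn 2) ⊕ const (ℚn 3) ⊛ y)) (≐-sym A-quadratic)
      (solve 3 (λ z a b → let open Syntax z a; c′ = z :* (con (ℚn 2) :+ con (ℚn 3) :* y′) in
          b :* 1-3y²′ :* O′ :+ 1-3y²′ :* (con 1ℚ :+ con (ℚn 3) :* z :^ 2 :- z :* (a :* T′)) :+ c′ :* (a :* 1-2y′)
        := 1-4y²′ :* O′ :+ 1-3y²′ :* (b :* O′) :+ c′ :* (z :* (con 1ℚ :- y′ :- y′ :* y′)))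
        ≐-refl X A B)))

  B-inverse : (1ₛ ⊕ σ) ⊛ B ≐ 1ₛ
  B-inverse = ⊛-cancelʳ 1-4y² (≐-by-relation 1ₛ B-quadratic (≐-by-relation (y ⊛ B) s⊛1-4y²≐y
    (solve 4 (λ z a b s → let open Syntax z a in
        (con 1ℚ :+ σ′ s) :* b :* 1-4y²′ :+ con 1ℚ :* 1-4y²′ :+ y′ :* b :* y′
      := con 1ℚ :* 1-4y²′ :+ con 1ℚ :* (b :* 1-3y²′) :+ y′ :* b :* (s :* 1-4y²′))
      ≐-refl X A B s)))

  closedForm : ℕ → Series
  closedForm k = A ^^ k ⊛ B

  stateSeries : State → Series
  stateSeries (lastU zero)    = 1ₛ
  stateSeries (lastU (suc h)) = closedForm (suc h)
  stateSeries (lastD true h)  = δ ⊛ closedForm h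
  stateSeries (lastD false h) = σ ⊛ closedForm h
  stateSeries (lastR true h)  = ρ ⊛ closedForm h
  stateSeries (lastR false h) = σ ⊛ closedForm h

  even-run-transfer : (h : ℕ) →
    σ ⊛ closedForm h ≐ const 0ℚ ⊕ X ⊛ (δ ⊛ closedForm (suc h) ⊕ (ρ ⊛ closedForm (suc h) ⊕ 0ₛ))
  even-run-transfer h = ≐-by-relation (y ⊛ closedForm h) s⊛1-4y²≐y
    (solve 5 (λ z a s p b → let open Syntax z a; g′ = a :* p :* b in
        σ′ s :* (p :* b) :+ y′ :* (p :* b) :* y′
      := con 0ℚ :+ z :* (δ′ s :* g′ :+ (ρ′ s :* g′ :+ con 0ℚ)) :+ y′ :* (p :* b) :* (s :* 1-4y²′))
      ≐-refl X A s (A ^^ h) B)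

  stateSeries-transfer : (q : State) →
    stateSeries q ≐ const (ℚn (endCount q 0)) ⊕ X ⊛ ⨁ (map stateSeries (predecessors q))
  stateSeries-transfer (lastU zero) = solve 1 (λ z → con 1ℚ := con 1ℚ :+ z :* con 0ℚ) ≐-refl X
  stateSeries-transfer (lastU (suc zero)) = ≐-by-relation B A-fixpoint (≐-by-relation X B-inverse
    (solve 4 (λ z a s b → let open Syntax z a in
        a :* con 1ℚ :* b :+ b :* (z :* (con 1ℚ :+ σ′ s :+ δ′ s)) :+ z :* con 1ℚ
      := con 0ℚ :+ z :* (con 1ℚ :+ (δ′ s :* (con 1ℚ :* b) :+ con 0ℚ)) :+ b :* a :+ z :* ((con 1ℚ :+ σ′ s) :* b))
      ≐-refl X A s B))
  stateSeries-transfer (lastU (suc (suc h))) = ≐-by-relation (closedForm (suc h)) A-fixpoint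
    (solve 5 (λ z a s p b → let open Syntax z a; g′ = a :* p :* b in
        a :* (a :* p) :* b :+ g′ :* (z :* (con 1ℚ :+ σ′ s :+ δ′ s))
      := con 0ℚ :+ z :* (g′ :+ (σ′ s :* g′ :+ (δ′ s :* g′ :+ con 0ℚ))) :+ g′ :* a)
      ≐-refl X A s (A ^^ h) B)
  stateSeries-transfer (lastD true h) =
    solve 5 (λ z a s p b → let open Syntax z a; g′ = a :* p :* b in
        δ′ s :* (p :* b) := con 0ℚ :+ z :* (g′ :+ (σ′ s :* g′ :+ (σ′ s :* g′ :+ con 0ℚ))))
      ≐-refl X A s (A ^^ h) B
  stateSeries-transfer (lastD false h) = even-run-transfer h
  stateSeries-transfer (lastR true h) =
    solve 5 (λ z a s p b → let open Syntax z a; g′ = a :* p :* b in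
        ρ′ s :* (p :* b) := con 0ℚ :+ z :* (σ′ s :* g′ :+ (σ′ s :* g′ :+ con 0ℚ)))
      ≐-refl X A s (A ^^ h) B
  stateSeries-transfer (lastR false h) = even-run-transfer h

open PowerSeries using (transfer-coefficients)
open Automaton using (lastU)
open WordCounts using (predecessors; endCount; endCount-suc; gCount-endCount)
open ClosedForms using (stateSeries; stateSeries-transfer)

gSeries-stateSeries : (k : ℕ) → gSeries k ≐ stateSeries (lastU k)
gSeries-stateSeries k n = trans (cong ℚn (gCount-endCount k n))
  (sym (transfer-coefficients predecessors endCount stateSeries endCount-suc stateSeries-transfer n (lastU k)))

mainTheorem4 : (gSeries 0 ≐ const 1ℚ)
               × (∀ (k : ℕ) → 1 ≤ k → gSeries k ≐ gFormula k)
mainTheorem4 = gSeries-stateSeries 0 , λ { (suc h) _ → gSeries-stateSeries (suc h) }
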